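{- Let $n\geq 2$ and $1\leq g\leq n-1$. The $g$-good-neighbour diagnosability of the $n$-dimensional hierarchical cubic network $HCN_{n}$ under the $MM^{*}$ model satisfies $t_{g}(HCN_{n})\leq 2^{g}(n+2-g)-1$.
   Context: For $n\ge 1$ let $V_n=\{0,1\}^n$; for $x\in V_n$, $\overline{x}$ denotes its bitwise complement. $HCN_n$ has vertex set $V_n\times V_n$. For each $x\in V_n$, the vertices $\{(x,y):y\in V_n\}$ induce a copy $xQ_n$ of the $n$-dimensional hypercube ($(x,y)\sim(x,y')$ iff $y,y'$ differ in exactly one bit). In addition, each vertex $(x,y)$ is joined to $(y,x)$ if $x\neq y$, and to $(\overline{x},\overline{y})$ if $x=y$. These are all the edges. A set $F\subset V(G)$ (proper subset) is a $g$-good-neighbour faulty set if every vertex of $V(G)\setminus F$ has at least $g$ neighbours in $V(G)\setminus F$. $MM^{*}$ model: for every vertex $w$ and every pair of distinct neighbours $u,v$ of $w$, $w$ compares the responses of $u$ and $v$; the outcome is $0$ if $w,u,v$ are all fault-free, $1$ if $w$ is fault-free and at least one of $u,v$ is faulty, and arbitrary if $w$ is faulty. A syndrome is a collection of all comparison outcomes; $F$ is consistent with $\sigma$ if $\sigma$ can arise when exactly the vertices of $F$ are faulty. Distinct $F_1,F_2$ are distinguishable if no syndrome is consistent with both. $G$ is $g$-good-neighbour $t$-diagnosable if every two distinct $g$-good-neighbour faulty sets of size at most $t$ are distinguishable; $t_g(G)$ is the maximum such $t$. -}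

module Defs where

open import Data.Bool using (Bool; true; false; not; _∧_; _∨_; if_then_else_)
open import Data.Nat using (ℕ; zero; suc; _+_; _≤_)
open import Data.List using (List; []; _∷_; _++_; map; concatMap; length; filter; foldr)
open import Data.Vec using (Vec; []; _∷_)
open import Data.Product using (_×_; _,_; Σ; ∃)
open import Relation.Binary.PropositionalEquality using (_≡_; _≢_)
open import Relation.Nullary using (¬_)

Bits : ℕ → Set
Bits n = Vec Bool n

allBits : (n : ℕ) → List (Bits n)
allBits zero = [] ∷ []
allBits (suc n) = map (true ∷_) (allBits n) ++ map (false ∷_) (allBits n)

eqBool : Bool → Bool → Bool
eqBool true b = b
eqBool false b = not b

eqBits : {n : ℕ} → Bits n → Bits n → Bool
eqBits [] [] = true
eqBits (a ∷ x) (b ∷ y) = eqBool a b ∧ eqBits x y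

compl : {n : ℕ} → Bits n → Bits n
compl [] = []
compl (a ∷ x) = not a ∷ compl x

hamming : {n : ℕ} → Bits n → Bits n → ℕ
hamming [] [] = zero
hamming (a ∷ x) (b ∷ y) = (if eqBool a b then 0 else 1) + hamming x y

isOne : ℕ → Bool
isOne (suc zero) = true
isOne _ = false

Vertex : ℕ → Set
Vertex n = Bits n × Bits n

allVertices : (n : ℕ) → List (Vertex n)
allVertices n = concatMap (λ x → map (λ y → (x , y)) (allBits n)) (allBits n)

adj : {n : ℕ} → Vertex n → Vertex n → Bool
adj (x , y) (x' , y') =
  -- hypercube edge inside xQ_n
  (eqBits x x' ∧ isOne (hamming y y'))
  ∨ (not (eqBits x y) ∧ (eqBits x' y ∧ eqBits y' x))
  ∨ (eqBits x y ∧ (eqBits x' (compl x) ∧ eqBits y' (compl y)))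

count : {A : Set} → (A → Bool) → List A → ℕ
count p [] = zero
count p (a ∷ as) = (if p a then 1 else 0) + count p as

VSet : ℕ → Set
VSet n = Vertex n → Bool

size : {n : ℕ} → VSet n → ℕ
size {n} F = count F (allVertices n)

Proper : {n : ℕ} → VSet n → Set
Proper {n} F = ∃ λ (v : Vertex n) → F v ≡ false

GoodNeighbourFaulty : {n : ℕ} → ℕ → VSet n → Set
GoodNeighbourFaulty {n} g F =
  Proper F ×
  ((v : Vertex n) → F v ≡ false →
     g ≤ count (λ u → adj v u ∧ not (F u)) (allVertices n))

-- syndrome: outcome σ w u v of w comparing u and v (true = 1, false = 0)
Syndrome : ℕ → Set
Syndrome n = Vertex n → Vertex n → Vertex n → Bool

-- F is consistent with σ under the MM* model (outcomes at faulty w arbitrary)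
Consistent : {n : ℕ} → VSet n → Syndrome n → Set
Consistent {n} F σ =
  (w u v : Vertex n) → adj w u ≡ true → adj w v ≡ true → u ≢ v →
  F w ≡ false → σ w u v ≡ (F u ∨ F v)

Distinguishable : {n : ℕ} → VSet n → VSet n → Set
Distinguishable {n} F₁ F₂ = ¬ (Σ (Syndrome n) λ σ → Consistent F₁ σ × Consistent F₂ σ)

Distinct : {n : ℕ} → VSet n → VSet n → Set
Distinct {n} F₁ F₂ = ¬ ((v : Vertex n) → F₁ v ≡ F₂ v)

GoodNeighbourDiagnosable : (n g t : ℕ) → Set
GoodNeighbourDiagnosable n g t =
  (F₁ F₂ : VSet n) → GoodNeighbourFaulty g F₁ → GoodNeighbourFaulty g F₂ →
  size F₁ ≤ t → size F₂ ≤ t → Distinct F₁ F₂ → Distinguishable F₁ F₂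

-- Write n = k + g with k ≥ 1 and let A = {0ⁿ} × {0ᵏ} × Q_g, a g-dimensional subcube of 0Q_n, so
-- every vertex of A has g neighbours in A.  Its closed neighbourhood N[A] and open neighbourhood
-- N(A) = N[A] ∖ A are both g-good-neighbour faulty sets: off the cube 0Q_n each cube xQ_n meets
-- N[A] in at most one vertex, and inside 0Q_n membership only depends on the first k bits.  They
-- differ exactly on A, and no vertex outside N[A] is adjacent to A, so the syndrome that reports
-- the faults of N(A) is consistent with both.  Finally |N(A)| < |N[A]| = 2ᵍ + k 2ᵍ + (2ᵍ − 1) + 1
-- = 2ᵍ (k + 2).
module Submission where

open import Data.Bool using (Bool; true; false; not; _∧_; _∨_; if_then_else_)
open import Data.Bool.Properties
  using (∧-conicalˡ; ∧-conicalʳ; ∧-identityʳ; ∧-zeroʳ; ∨-identityʳ; ∨-zeroʳ; not-injective)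
open import Data.List using (List; []; _∷_; _++_; map; concatMap; length)
open import Data.List.Properties using (length-++; length-map)
open import Data.Nat using (ℕ; zero; suc; _+_; _*_; _∸_; _^_; _≤_; _<_; z≤n; s≤s; pred)
open import Data.Nat.Properties
open import Data.Nat.Tactic.RingSolver using (solve-∀)
open import Data.Product using (Σ; _×_; _,_; proj₁; proj₂)
open import Data.Vec using ([]; _∷_; replicate)
open import Function using (_∘_)
open import Relation.Binary.PropositionalEquality
open import Relation.Nullary using (¬_)

open import Defs

contraposeᵇ : {a b : Bool} → (a ≡ true → b ≡ true) → b ≡ false → a ≡ false
contraposeᵇ {false} _ _ = refl
contraposeᵇ {true}  h b≡false = trans (sym (h refl)) b≡false

infixr 6 _∪_
infixr 7 _∩_ _∖_

_∪_ _∩_ _∖_ : {A : Set} → (A → Bool) → (A → Bool) → A → Bool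
(p ∪ q) a = p a ∨ q a
(p ∩ q) a = p a ∧ q a
(p ∖ q) a = p a ∧ not (q a)

module _ {A : Set} where

  count-++ : (p : A → Bool) (xs ys : List A) → count p (xs ++ ys) ≡ count p xs + count p ys
  count-++ p []       ys = refl
  count-++ p (x ∷ xs) ys =
    trans (cong (_ +_) (count-++ p xs ys)) (sym (+-assoc (if p x then 1 else 0) (count p xs) _))

  count-≗ : {p q : A → Bool} → (∀ a → p a ≡ q a) → (xs : List A) → count p xs ≡ count q xs
  count-≗ p≗q []       = refl
  count-≗ p≗q (x ∷ xs) = cong₂ _+_ (cong (λ b → if b then 1 else 0) (p≗q x)) (count-≗ p≗q xs)

  count-mono : {p q : A → Bool} → (∀ a → p a ≡ true → q a ≡ true) →
               (xs : List A) → count p xs ≤ count q xs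
  count-mono p⊆q [] = z≤n
  count-mono {p} p⊆q (x ∷ xs) with p x in px
  ... | true rewrite p⊆q x px = s≤s (count-mono p⊆q xs)
  ... | false = ≤-trans (count-mono p⊆q xs) (m≤n+m _ _)

  count-false : (xs : List A) → count (λ _ → false) xs ≡ 0
  count-false []       = refl
  count-false (_ ∷ xs) = count-false xs

  count-true : (xs : List A) → count (λ _ → true) xs ≡ length xs
  count-true []       = refl
  count-true (_ ∷ xs) = cong suc (count-true xs)

  count-∩+count-∖ : (p q : A → Bool) (xs : List A) →
                    count (p ∩ q) xs + count (p ∖ q) xs ≡ count p xs
  count-∩+count-∖ p q [] = refl
  count-∩+count-∖ p q (x ∷ xs) with p x | q x
  ... | true  | true  = cong suc (count-∩+count-∖ p q xs)
  ... | true  | false = trans (+-suc _ _) (cong suc (count-∩+count-∖ p q xs))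
  ... | false | _     = count-∩+count-∖ p q xs

  count-∪-≤ : (p q : A → Bool) (xs : List A) → count (p ∪ q) xs ≤ count p xs + count q xs
  count-∪-≤ p q [] = z≤n
  count-∪-≤ p q (x ∷ xs) with p x | q x
  ... | true  | true  = s≤s (≤-trans (count-∪-≤ p q xs) (+-monoʳ-≤ _ (n≤1+n _)))
  ... | true  | false = s≤s (count-∪-≤ p q xs)
  ... | false | true  = ≤-trans (s≤s (count-∪-≤ p q xs)) (≤-reflexive (sym (+-suc _ _)))
  ... | false | false = count-∪-≤ p q xs

count-map : {A B : Set} (p : B → Bool) (f : A → B) (xs : List A) →
            count p (map f xs) ≡ count (p ∘ f) xs
count-map p f []       = refl
count-map p f (x ∷ xs) = cong (_ +_) (count-map p f xs)

count-pairs : {A B : Set} (p : A → Bool) (q : B → Bool) (xs : List A) (ys : List B) →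
              count (λ ab → p (proj₁ ab) ∧ q (proj₂ ab)) (concatMap (λ x → map (x ,_) ys) xs)
              ≡ count p xs * count q ys
count-pairs p q []       ys = refl
count-pairs p q (x ∷ xs) ys = begin
  count r (map (x ,_) ys ++ concatMap (λ x → map (x ,_) ys) xs)
    ≡⟨ count-++ r (map (x ,_) ys) _ ⟩
  count r (map (x ,_) ys) + count r (concatMap (λ x → map (x ,_) ys) xs)
    ≡⟨ cong₂ _+_ (trans (count-map r (x ,_) ys) (count-const-∧ (p x))) (count-pairs p q xs ys) ⟩
  (if p x then 1 else 0) * count q ys + count p xs * count q ys
    ≡⟨ sym (*-distribʳ-+ (count q ys) (if p x then 1 else 0) (count p xs)) ⟩
  count p (x ∷ xs) * count q ys ∎
  where
  open ≡-Reasoning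
  r = λ ab → p (proj₁ ab) ∧ q (proj₂ ab)
  count-const-∧ : (b : Bool) → count (λ y → b ∧ q y) ys ≡ (if b then 1 else 0) * count q ys
  count-const-∧ true  = sym (*-identityˡ _)
  count-const-∧ false = count-false ys

zeros ones : (n : ℕ) → Bits n
zeros n = replicate n false
ones  n = replicate n true

isZero isOnes : {n : ℕ} → Bits n → Bool
isZero = eqBits (zeros _)
isOnes = eqBits (ones _)

hypercubeAdj : {n : ℕ} → Bits n → Bits n → Bool
hypercubeAdj y y′ = isOne (hamming y y′)

eqBits-refl : {n : ℕ} (x : Bits n) → eqBits x x ≡ true
eqBits-refl []          = refl
eqBits-refl (true ∷ x)  = eqBits-refl x
eqBits-refl (false ∷ x) = eqBits-refl x

eqBits⇒≡ : {n : ℕ} {x y : Bits n} → eqBits x y ≡ true → x ≡ y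
eqBits⇒≡ {x = []}        {[]}        _ = refl
eqBits⇒≡ {x = true ∷ x}  {true ∷ y}  e = cong (true ∷_) (eqBits⇒≡ e)
eqBits⇒≡ {x = false ∷ x} {false ∷ y} e = cong (false ∷_) (eqBits⇒≡ e)

eqBits-sym : {n : ℕ} (x y : Bits n) → eqBits x y ≡ eqBits y x
eqBits-sym []          []          = refl
eqBits-sym (true ∷ x)  (true ∷ y)  = eqBits-sym x y
eqBits-sym (false ∷ x) (false ∷ y) = eqBits-sym x y
eqBits-sym (true ∷ x)  (false ∷ y) = refl
eqBits-sym (false ∷ x) (true ∷ y)  = refl

isZero-compl : {n : ℕ} (x : Bits n) → isZero (compl x) ≡ isOnes x
isZero-compl []          = refl
isZero-compl (true ∷ x)  = isZero-compl x
isZero-compl (false ∷ x) = refl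

isOne-suc-hamming : {n : ℕ} (y y′ : Bits n) → isOne (suc (hamming y y′)) ≡ eqBits y y′
isOne-suc-hamming []          []           = refl
isOne-suc-hamming (true ∷ y)  (true ∷ y′)  = isOne-suc-hamming y y′
isOne-suc-hamming (false ∷ y) (false ∷ y′) = isOne-suc-hamming y y′
isOne-suc-hamming (true ∷ y)  (false ∷ y′) = refl
isOne-suc-hamming (false ∷ y) (true ∷ y′)  = refl

count-allBits-suc : {n : ℕ} (p : Bits (suc n) → Bool) →
  count p (allBits (suc n)) ≡ count (p ∘ (true ∷_)) (allBits n) + count (p ∘ (false ∷_)) (allBits n)
count-allBits-suc {n} p =
  trans (count-++ p (map (true ∷_) (allBits n)) _)
        (cong₂ _+_ (count-map p _ (allBits n)) (count-map p _ (allBits n)))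

length-allBits : (n : ℕ) → length (allBits n) ≡ 2 ^ n
length-allBits zero    = refl
length-allBits (suc n) = begin
  length (map (true ∷_) (allBits n) ++ map (false ∷_) (allBits n))
    ≡⟨ length-++ (map (true ∷_) (allBits n)) ⟩
  length (map (true ∷_) (allBits n)) + length (map (false ∷_) (allBits n))
    ≡⟨ cong₂ _+_ (length-map (true ∷_) (allBits n)) (length-map (false ∷_) (allBits n)) ⟩
  length (allBits n) + length (allBits n)
    ≡⟨ cong₂ _+_ (length-allBits n) (trans (length-allBits n) (sym (+-identityʳ _))) ⟩
  2 ^ suc n ∎
  where open ≡-Reasoning

count-eqBits : {n : ℕ} (x : Bits n) → count (eqBits x) (allBits n) ≡ 1
count-eqBits []                  = refl
count-eqBits {suc n} (true ∷ x)  =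
  trans (count-allBits-suc (eqBits (true ∷ x))) (cong₂ _+_ (count-eqBits x) (count-false (allBits n)))
count-eqBits {suc n} (false ∷ x) =
  trans (count-allBits-suc (eqBits (false ∷ x))) (cong₂ _+_ (count-false (allBits n)) (count-eqBits x))

count-hypercubeAdj : {n : ℕ} (y : Bits n) → count (hypercubeAdj y) (allBits n) ≡ n
count-hypercubeAdj []                  = refl
count-hypercubeAdj {suc n} (true ∷ y)  =
  trans (count-allBits-suc (hypercubeAdj (true ∷ y)))
        (trans (cong₂ _+_ (count-hypercubeAdj y) flipped-first) (+-comm n 1))
  where
  flipped-first : count (λ y′ → isOne (suc (hamming y y′))) (allBits n) ≡ 1
  flipped-first = trans (count-≗ (isOne-suc-hamming y) (allBits n)) (count-eqBits y)
count-hypercubeAdj {suc n} (false ∷ y) =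
  trans (count-allBits-suc (hypercubeAdj (false ∷ y)))
        (cong₂ _+_ (trans (count-≗ (isOne-suc-hamming y) (allBits n)) (count-eqBits y))
                   (count-hypercubeAdj y))

zeroPrefix : (k : ℕ) {m : ℕ} → Bits (k + m) → Bool
zeroPrefix zero    _       = true
zeroPrefix (suc k) (b ∷ y) = not b ∧ zeroPrefix k y

weightOnePrefix : (k : ℕ) {m : ℕ} → Bits (k + m) → Bool
weightOnePrefix zero    _       = false
weightOnePrefix (suc k) (b ∷ y) = if b then zeroPrefix k y else weightOnePrefix k y

suffixAdj : (k : ℕ) {m : ℕ} → Bits (k + m) → Bits (k + m) → Bool
suffixAdj zero    y       y′        = hypercubeAdj y y′
suffixAdj (suc k) (b ∷ y) (b′ ∷ y′) = eqBool b b′ ∧ suffixAdj k y y′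

count-zeroPrefix : (k m : ℕ) → count (zeroPrefix k {m}) (allBits (k + m)) ≡ 2 ^ m
count-zeroPrefix zero    m = trans (count-true (allBits m)) (length-allBits m)
count-zeroPrefix (suc k) m = trans (count-allBits-suc (zeroPrefix (suc k)))
                                   (cong₂ _+_ (count-false (allBits (k + m))) (count-zeroPrefix k m))

count-weightOnePrefix : (k m : ℕ) → count (weightOnePrefix k {m}) (allBits (k + m)) ≡ k * 2 ^ m
count-weightOnePrefix zero    m = count-false (allBits m)
count-weightOnePrefix (suc k) m = trans (count-allBits-suc (weightOnePrefix (suc k)))
                                        (cong₂ _+_ (count-zeroPrefix k m) (count-weightOnePrefix k m))

count-suffixAdj : (k : ℕ) {m : ℕ} (y : Bits (k + m)) → count (suffixAdj k y) (allBits (k + m)) ≡ m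
count-suffixAdj zero    y = count-hypercubeAdj y
count-suffixAdj (suc k) {m} (true ∷ y) =
  trans (count-allBits-suc (suffixAdj (suc k) (true ∷ y)))
        (trans (cong₂ _+_ (count-suffixAdj k y) (count-false (allBits (k + m)))) (+-identityʳ m))
count-suffixAdj (suc k) {m} (false ∷ y) =
  trans (count-allBits-suc (suffixAdj (suc k) (false ∷ y)))
        (cong₂ _+_ (count-false (allBits (k + m))) (count-suffixAdj k y))

suffixAdj⇒hypercubeAdj : (k : ℕ) {m : ℕ} (y y′ : Bits (k + m)) →
                         suffixAdj k y y′ ≡ true → hypercubeAdj y y′ ≡ true
suffixAdj⇒hypercubeAdj zero y y′ e = e
suffixAdj⇒hypercubeAdj (suc k) (true ∷ y)  (true ∷ y′)  e = suffixAdj⇒hypercubeAdj k y y′ e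
suffixAdj⇒hypercubeAdj (suc k) (false ∷ y) (false ∷ y′) e = suffixAdj⇒hypercubeAdj k y y′ e

suffixAdj-zeroPrefix : (k : ℕ) {m : ℕ} (y y′ : Bits (k + m)) →
                       suffixAdj k y y′ ≡ true → zeroPrefix k y′ ≡ zeroPrefix k y
suffixAdj-zeroPrefix zero y y′ _ = refl
suffixAdj-zeroPrefix (suc k) (true ∷ y)  (true ∷ y′)  _ = refl
suffixAdj-zeroPrefix (suc k) (false ∷ y) (false ∷ y′) e = suffixAdj-zeroPrefix k y y′ e

suffixAdj-weightOnePrefix : (k : ℕ) {m : ℕ} (y y′ : Bits (k + m)) →
                            suffixAdj k y y′ ≡ true → weightOnePrefix k y′ ≡ weightOnePrefix k y
suffixAdj-weightOnePrefix zero y y′ _ = refl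
suffixAdj-weightOnePrefix (suc k) (true ∷ y)  (true ∷ y′)  e = suffixAdj-zeroPrefix k y y′ e
suffixAdj-weightOnePrefix (suc k) (false ∷ y) (false ∷ y′) e = suffixAdj-weightOnePrefix k y y′ e

hypercubeAdj-zeroPrefix : (k : ℕ) {m : ℕ} (y y′ : Bits (k + m)) → zeroPrefix k y′ ≡ true →
                          hypercubeAdj y y′ ≡ true → (zeroPrefix k ∪ weightOnePrefix k) y ≡ true
hypercubeAdj-zeroPrefix zero y y′ _ _ = refl
hypercubeAdj-zeroPrefix (suc k) (false ∷ y) (false ∷ y′) z′ a = hypercubeAdj-zeroPrefix k y y′ z′ a
hypercubeAdj-zeroPrefix (suc k) (true ∷ y)  (false ∷ y′) z′ a =
  subst (λ z → zeroPrefix k z ≡ true) (sym (eqBits⇒≡ (trans (sym (isOne-suc-hamming y y′)) a))) z′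

zeroPrefix-zeros : (k m : ℕ) → zeroPrefix k {m} (zeros (k + m)) ≡ true
zeroPrefix-zeros zero    m = refl
zeroPrefix-zeros (suc k) m = zeroPrefix-zeros k m

weightOnePrefix-zeros : (k m : ℕ) → weightOnePrefix k {m} (zeros (k + m)) ≡ false
weightOnePrefix-zeros zero    m = refl
weightOnePrefix-zeros (suc k) m = weightOnePrefix-zeros k m

_⊗_ : {n : ℕ} → (Bits n → Bool) → (Bits n → Bool) → VSet n
(X ⊗ Y) u = X (proj₁ u) ∧ Y (proj₂ u)

size-⊗ : {n : ℕ} (X Y : Bits n → Bool) → size (X ⊗ Y) ≡ count X (allBits n) * count Y (allBits n)
size-⊗ {n} X Y = count-pairs X Y (allBits n) (allBits n)

goodNeighbours : {n : ℕ} → VSet n → Vertex n → ℕ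
goodNeighbours {n} F v = count (λ u → adj v u ∧ not (F u)) (allVertices n)

data Edge {n : ℕ} : Vertex n → Vertex n → Set where
  cube      : {x y y′ : Bits n} → hypercubeAdj y y′ ≡ true → Edge (x , y) (x , y′)
  swap      : {x y : Bits n} → eqBits x y ≡ false → Edge (x , y) (y , x)
  antipodal : {x : Bits n} → Edge (x , x) (compl x , compl x)

adj⇒Edge : {n : ℕ} (u v : Vertex n) → adj u v ≡ true → Edge u v
adj⇒Edge (x , y) (x′ , y′) e with eqBits x x′ ∧ hypercubeAdj y y′ in c
... | true with eqBits⇒≡ {x = x} {x′} (∧-conicalˡ _ _ c)
...   | refl = cube (∧-conicalʳ (eqBits x x) _ c)
adj⇒Edge (x , y) (x′ , y′) e | false with not (eqBits x y) ∧ (eqBits x′ y ∧ eqBits y′ x) in s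
... | true with ∧-conicalʳ (not (eqBits x y)) _ s
...   | images with eqBits⇒≡ {x = x′} {y} (∧-conicalˡ _ _ images)
                  | eqBits⇒≡ {x = y′} {x} (∧-conicalʳ (eqBits x′ y) _ images)
...     | refl | refl = swap (not-injective (∧-conicalˡ _ _ s))
adj⇒Edge (x , y) (x′ , y′) e | false | false with eqBits⇒≡ {x = x} {y} (∧-conicalˡ _ _ e)
... | refl with ∧-conicalʳ (eqBits x x) _ e
...   | images with eqBits⇒≡ {x = x′} {compl x} (∧-conicalˡ _ _ images)
                  | eqBits⇒≡ {x = y′} {compl x} (∧-conicalʳ (eqBits x′ (compl x)) _ images)
...     | refl | refl = antipodal

adj-cube : {n : ℕ} {x y y′ : Bits n} → hypercubeAdj y y′ ≡ true → adj (x , y) (x , y′) ≡ true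
adj-cube {x = x} a rewrite eqBits-refl x | a = refl

count≤goodNeighbours : {n : ℕ} (F : VSet n) (x y : Bits n) (h : Bits n → Bool) →
  (∀ y′ → h y′ ≡ true → hypercubeAdj y y′ ≡ true × F (x , y′) ≡ false) →
  count h (allBits n) ≤ goodNeighbours F (x , y)
count≤goodNeighbours {n} F x y h good = begin
  count h (allBits n)                                 ≡⟨ sym (*-identityˡ _) ⟩
  1 * count h (allBits n)                             ≡⟨ cong (_* _) (sym (count-eqBits x)) ⟩
  count (eqBits x) (allBits n) * count h (allBits n)  ≡⟨ sym (size-⊗ (eqBits x) h) ⟩
  size (eqBits x ⊗ h)                                 ≤⟨ count-mono good-neighbour (allVertices n) ⟩
  goodNeighbours F (x , y)                            ∎
  where
  open ≤-Reasoning
  good-neighbour : ∀ u → (eqBits x ⊗ h) u ≡ true → adj (x , y) u ∧ not (F u) ≡ true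
  good-neighbour (x′ , y′) e with sym (eqBits⇒≡ {x = x} {x′} (∧-conicalˡ _ _ e))
  ... | refl = let adjacent , fault-free = good y′ (∧-conicalʳ (eqBits x x) _ e)
               in cong₂ _∧_ (adj-cube {x = x} {y} {y′} adjacent) (cong not fault-free)

cube-goodNeighbours : {n : ℕ} (F : VSet n) (x c : Bits n) → (∀ y′ → F (x , y′) ≡ true → y′ ≡ c) →
                      (y : Bits n) → n ∸ 1 ≤ goodNeighbours F (x , y)
cube-goodNeighbours {n} F x c F⊆c y =
  ≤-trans (m≤n+o⇒m∸n≤o n 1 n≤1+others) (count≤goodNeighbours F x y others good)
  where
  others = hypercubeAdj y ∖ eqBits c
  open ≤-Reasoning
  n≤1+others : n ≤ 1 + count others (allBits n)
  n≤1+others = begin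
    n
      ≡⟨ sym (count-hypercubeAdj y) ⟩
    count (hypercubeAdj y) (allBits n)
      ≡⟨ sym (count-∩+count-∖ _ _ (allBits n)) ⟩
    count (hypercubeAdj y ∩ eqBits c) (allBits n) + count others (allBits n)
      ≤⟨ +-monoˡ-≤ _ (count-mono (λ _ → ∧-conicalʳ _ _) (allBits n)) ⟩
    count (eqBits c) (allBits n) + count others (allBits n)
      ≡⟨ cong (_+ count others (allBits n)) (count-eqBits c) ⟩
    1 + count others (allBits n) ∎
  good : ∀ y′ → others y′ ≡ true → hypercubeAdj y y′ ≡ true × F (x , y′) ≡ false
  good y′ e = ∧-conicalˡ _ _ e
            , contraposeᵇ (λ f → trans (cong (eqBits c) (F⊆c y′ f)) (eqBits-refl c))
                          (not-injective (∧-conicalʳ (hypercubeAdj y y′) _ e))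

suffix-goodNeighbours : (k : ℕ) {m : ℕ} (F : VSet (k + m)) (x y : Bits (k + m)) →
  (∀ y′ → suffixAdj k y y′ ≡ true → F (x , y′) ≡ F (x , y)) →
  F (x , y) ≡ false → m ≤ goodNeighbours F (x , y)
suffix-goodNeighbours k {m} F x y invariant fault-free =
  subst (_≤ goodNeighbours F (x , y)) (count-suffixAdj k y)
        (count≤goodNeighbours F x y (suffixAdj k y)
          λ y′ e → suffixAdj⇒hypercubeAdj k y y′ e , trans (invariant y′ e) fault-free)

indistinguishable : {n : ℕ} {F₁ F₂ : VSet n} →
  (∀ w u → F₂ w ≡ false → adj w u ≡ true → F₁ u ≡ F₂ u) → ¬ Distinguishable F₁ F₂
indistinguishable {F₁ = F₁} agree distinguishable =
  distinguishable ( (λ _ u v → F₁ u ∨ F₁ v)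
                  , (λ _ _ _ _ _ _ _ → refl)
                  , λ w u v wu wv _ w∉F₂ → cong₂ _∨_ (agree w u w∉F₂ wu) (agree w v w∉F₂ wv))

diagnosability-bound : {n g t b : ℕ} {F₁ F₂ : VSet n} →
  GoodNeighbourFaulty g F₁ → GoodNeighbourFaulty g F₂ → Distinct F₁ F₂ → ¬ Distinguishable F₁ F₂ →
  size F₁ ≤ b → size F₂ ≤ b → GoodNeighbourDiagnosable n g t → t < b
diagnosability-bound good₁ good₂ F₁≢F₂ indist size₁ size₂ diagnosable = ≰⇒> λ b≤t →
  indist (diagnosable _ _ good₁ good₂ (≤-trans size₁ b≤t) (≤-trans size₂ b≤t) F₁≢F₂)

module SubcubeNeighbourhood (k′ g : ℕ) where

  k n : ℕ
  k = suc k′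
  n = k + g

  subcube openNbhd closedNbhd : VSet n
  subcube    = isZero ⊗ zeroPrefix k
  -- The neighbours of the subcube are reached along 0Q_n, along the swap edges (0, y) ~ (y, 0)
  -- with y ≠ 0, and along the antipodal edge (0, 0) ~ (1, 1).
  openNbhd   = isZero ⊗ weightOnePrefix k ∪ (zeroPrefix k ∖ isZero) ⊗ isZero ∪ isOnes ⊗ isOnes
  closedNbhd = subcube ∪ openNbhd

  isZero-zeros : isZero (zeros n) ≡ true
  isZero-zeros = eqBits-refl (zeros n)

  subcube-zeros : (y : Bits n) → subcube (zeros n , y) ≡ zeroPrefix k y
  subcube-zeros y rewrite isZero-zeros = refl

  openNbhd-zeros : (y : Bits n) → openNbhd (zeros n , y) ≡ weightOnePrefix k y
  openNbhd-zeros y rewrite isZero-zeros | ∧-zeroʳ (zeroPrefix k (zeros n)) = ∨-identityʳ _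

  closedNbhd-nonzero : (x y : Bits n) → isZero x ≡ false →
                       closedNbhd (x , y) ≡ (zeroPrefix k x ∧ isZero y) ∨ (isOnes x ∧ isOnes y)
  closedNbhd-nonzero x y x≢0 rewrite x≢0 | ∧-identityʳ (zeroPrefix k x) = refl

  closedNbhd-nonzero-⊆-point : (x : Bits n) → isZero x ≡ false →
                               Σ (Bits n) λ c → ∀ y → closedNbhd (x , y) ≡ true → y ≡ c
  -- As k ≥ 1, the first bit of x excludes either a zero prefix of x or x = 1ⁿ.
  closedNbhd-nonzero-⊆-point (true ∷ x) x≢0 = ones n , λ y e →
    sym (eqBits⇒≡ (∧-conicalʳ (isOnes (true ∷ x)) _
      (trans (sym (closedNbhd-nonzero (true ∷ x) y x≢0)) e)))
  closedNbhd-nonzero-⊆-point (false ∷ x) x≢0 = zeros n , λ y e →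
    sym (eqBits⇒≡ (∧-conicalʳ (zeroPrefix k (false ∷ x)) _
      (trans (sym (∨-identityʳ _)) (trans (sym (closedNbhd-nonzero (false ∷ x) y x≢0)) e))))

  closedNbhd-ones-zeros : closedNbhd (ones n , zeros n) ≡ false
  closedNbhd-ones-zeros = trans (closedNbhd-nonzero (ones n) (zeros n) refl) (∧-zeroʳ (isOnes (ones n)))

  subcube-suffixInvariant : (y y′ : Bits n) → suffixAdj k y y′ ≡ true →
                            subcube (zeros n , y′) ≡ subcube (zeros n , y)
  subcube-suffixInvariant y y′ e = begin
    subcube (zeros n , y′)  ≡⟨ subcube-zeros y′ ⟩
    zeroPrefix k y′         ≡⟨ suffixAdj-zeroPrefix k y y′ e ⟩
    zeroPrefix k y          ≡⟨ sym (subcube-zeros y) ⟩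
    subcube (zeros n , y)   ∎
    where open ≡-Reasoning

  openNbhd-suffixInvariant : (y y′ : Bits n) → suffixAdj k y y′ ≡ true →
                             openNbhd (zeros n , y′) ≡ openNbhd (zeros n , y)
  openNbhd-suffixInvariant y y′ e = begin
    openNbhd (zeros n , y′)  ≡⟨ openNbhd-zeros y′ ⟩
    weightOnePrefix k y′     ≡⟨ suffixAdj-weightOnePrefix k y y′ e ⟩
    weightOnePrefix k y      ≡⟨ sym (openNbhd-zeros y) ⟩
    openNbhd (zeros n , y)   ∎
    where open ≡-Reasoning

  closedNbhd-suffixInvariant : (y y′ : Bits n) → suffixAdj k y y′ ≡ true →
                               closedNbhd (zeros n , y′) ≡ closedNbhd (zeros n , y)
  closedNbhd-suffixInvariant y y′ e =
    cong₂ _∨_ (subcube-suffixInvariant y y′ e) (openNbhd-suffixInvariant y y′ e)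

  closedNbhd-swap : (x : Bits n) → isZero x ≡ false → zeroPrefix k x ≡ true →
                    closedNbhd (x , zeros n) ≡ true
  closedNbhd-swap x x≢0 z rewrite closedNbhd-nonzero x (zeros n) x≢0 | z | isZero-zeros = refl

  closedNbhd-ones-ones : closedNbhd (ones n , ones n) ≡ true
  closedNbhd-ones-ones rewrite closedNbhd-nonzero (ones n) (ones n) refl | eqBits-refl (ones n) = refl

  adj-subcube⇒closedNbhd : (w u : Vertex n) → adj w u ≡ true → subcube u ≡ true →
                           closedNbhd w ≡ true
  adj-subcube⇒closedNbhd w u a = from-edge (adj⇒Edge w u a)
    where
    from-edge : {w u : Vertex n} → Edge w u → subcube u ≡ true → closedNbhd w ≡ true
    from-edge {x , y} {_ , y′} (cube adjacent) s with eqBits⇒≡ {x = zeros n} {x} (∧-conicalˡ _ _ s)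
    ... | refl = trans (cong₂ _∨_ (subcube-zeros y) (openNbhd-zeros y))
                       (hypercubeAdj-zeroPrefix k y y′ (∧-conicalʳ (isZero (zeros n)) _ s) adjacent)
    from-edge {x , y} (swap x≢y) s with eqBits⇒≡ {x = zeros n} {y} (∧-conicalˡ _ _ s)
    ... | refl =
      closedNbhd-swap x (trans (eqBits-sym (zeros n) x) x≢y) (∧-conicalʳ (isZero (zeros n)) _ s)
    from-edge {x , _} antipodal s
      with eqBits⇒≡ {x = ones n} {x} (trans (sym (isZero-compl x)) (∧-conicalˡ _ _ s))
    ... | refl = closedNbhd-ones-ones

  goodNeighbourFaulty : (F : VSet n) → (∀ u → F u ≡ true → closedNbhd u ≡ true) →
    (∀ y y′ → suffixAdj k y y′ ≡ true → F (zeros n , y′) ≡ F (zeros n , y)) →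
    GoodNeighbourFaulty g F
  goodNeighbourFaulty F F⊆N[A] invariant =
    ((ones n , zeros n) , contraposeᵇ (F⊆N[A] _) closedNbhd-ones-zeros) , good
    where
    good : ∀ w → F w ≡ false → g ≤ goodNeighbours F w
    good (x , y) w∉F with isZero x in x≟0
    ... | true with eqBits⇒≡ {x = zeros n} {x} x≟0
    ...   | refl = suffix-goodNeighbours k F (zeros n) y (invariant y) w∉F
    good (x , y) w∉F | false =
      let c , N[A]⊆c = closedNbhd-nonzero-⊆-point x x≟0
      in ≤-trans (m≤n+m g k′) (cube-goodNeighbours F x c (λ y′ e → N[A]⊆c y′ (F⊆N[A] _ e)) y)

  openNbhd⊆closedNbhd : (u : Vertex n) → openNbhd u ≡ true → closedNbhd u ≡ true
  openNbhd⊆closedNbhd u e = trans (cong (subcube u ∨_) e) (∨-zeroʳ (subcube u))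

  openNbhd≢closedNbhd : Distinct openNbhd closedNbhd
  openNbhd≢closedNbhd same with trans (sym origin∉N⟨A⟩) (trans (same origin) origin∈N[A])
    where
    origin = zeros n , zeros n
    origin∉N⟨A⟩ : openNbhd origin ≡ false
    origin∉N⟨A⟩ = trans (openNbhd-zeros (zeros n)) (weightOnePrefix-zeros k g)
    origin∈N[A] : closedNbhd origin ≡ true
    origin∈N[A] = cong (_∨ openNbhd origin) (trans (subcube-zeros (zeros n)) (zeroPrefix-zeros k g))
  ... | ()

  openNbhd-agrees-near-fault-free : ∀ w u → closedNbhd w ≡ false → adj w u ≡ true →
                                    openNbhd u ≡ closedNbhd u
  openNbhd-agrees-near-fault-free w u w∉N[A] a =
    sym (cong (_∨ openNbhd u) (contraposeᵇ (adj-subcube⇒closedNbhd w u a) w∉N[A]))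

  size-closedNbhd : size closedNbhd ≤ 2 ^ g * (k + 2)
  size-closedNbhd = begin
    size closedNbhd
      ≤⟨ count-∪-≤ subcube _ V ⟩
    size subcube + size openNbhd
      ≤⟨ +-monoʳ-≤ (size subcube) (count-∪-≤ inner _ V) ⟩
    size subcube + (size inner + size (swapped ∪ antipode))
      ≤⟨ +-monoʳ-≤ (size subcube) (+-monoʳ-≤ (size inner) (count-∪-≤ swapped antipode V)) ⟩
    size subcube + (size inner + (size swapped + size antipode))
      ≡⟨ cong₂ _+_ size-subcube (cong₂ _+_ size-inner (cong₂ _+_ size-swapped size-antipode)) ⟩
    2 ^ g + (k * 2 ^ g + (count (zeroPrefix k ∖ isZero) (allBits n) + 1))
      ≡⟨ cong (λ m → 2 ^ g + (k * 2 ^ g + m)) count-zeroPrefix∖isZero ⟩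
    2 ^ g + (k * 2 ^ g + 2 ^ g)
      ≡⟨ regroup (2 ^ g) k ⟩
    2 ^ g * (k + 2) ∎
    where
    open ≤-Reasoning
    V = allVertices n
    inner swapped antipode : VSet n
    inner    = isZero ⊗ weightOnePrefix k
    swapped  = (zeroPrefix k ∖ isZero) ⊗ isZero
    antipode = isOnes ⊗ isOnes
    count-isZero : count isZero (allBits n) ≡ 1
    count-isZero = count-eqBits (zeros n)
    size-subcube : size subcube ≡ 2 ^ g
    size-subcube = trans (size-⊗ {n} isZero (zeroPrefix k))
      (trans (cong₂ _*_ count-isZero (count-zeroPrefix k g)) (*-identityˡ _))
    size-inner : size inner ≡ k * 2 ^ g
    size-inner = trans (size-⊗ {n} isZero (weightOnePrefix k))
      (trans (cong₂ _*_ count-isZero (count-weightOnePrefix k g)) (*-identityˡ _))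
    size-swapped : size swapped ≡ count (zeroPrefix k ∖ isZero) (allBits n)
    size-swapped = trans (size-⊗ {n} (zeroPrefix k ∖ isZero) isZero)
      (trans (cong (count (zeroPrefix k ∖ isZero) (allBits n) *_) count-isZero) (*-identityʳ _))
    size-antipode : size antipode ≡ 1
    size-antipode =
      trans (size-⊗ {n} isOnes isOnes) (cong₂ _*_ (count-eqBits (ones n)) (count-eqBits (ones n)))
    count-zeroPrefix∖isZero : count (zeroPrefix k ∖ isZero) (allBits n) + 1 ≡ 2 ^ g
    count-zeroPrefix∖isZero = begin-equality
      count (zeroPrefix k ∖ isZero) (allBits n) + 1
        ≡⟨ +-comm _ 1 ⟩
      1 + count (zeroPrefix k ∖ isZero) (allBits n)
        ≡⟨ cong (_+ count (zeroPrefix k ∖ isZero) (allBits n)) (sym count-zeroPrefix∩isZero) ⟩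
      count (zeroPrefix k ∩ isZero) (allBits n) + count (zeroPrefix k ∖ isZero) (allBits n)
        ≡⟨ count-∩+count-∖ (zeroPrefix k) isZero (allBits n) ⟩
      count (zeroPrefix k) (allBits n)
        ≡⟨ count-zeroPrefix k g ⟩
      2 ^ g ∎
      where
      count-zeroPrefix∩isZero : count (zeroPrefix k ∩ isZero) (allBits n) ≡ 1
      count-zeroPrefix∩isZero = trans (count-≗ zeroPrefix∩isZero≗isZero (allBits n)) count-isZero
        where
        zeroPrefix∩isZero≗isZero : ∀ y → (zeroPrefix k ∩ isZero) y ≡ isZero y
        zeroPrefix∩isZero≗isZero y with isZero y in y≟0
        ... | false = ∧-zeroʳ (zeroPrefix k y)
        ... | true rewrite sym (eqBits⇒≡ {x = zeros n} {y} y≟0) =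
          trans (∧-identityʳ _) (zeroPrefix-zeros k g)
    regroup : ∀ P k → P + (k * P + P) ≡ P * (k + 2)
    regroup = solve-∀

  size-openNbhd : size openNbhd ≤ 2 ^ g * (k + 2)
  size-openNbhd = ≤-trans (count-mono openNbhd⊆closedNbhd (allVertices n)) size-closedNbhd

  not-diagnosable : {t : ℕ} → GoodNeighbourDiagnosable n g t → t < 2 ^ g * (k + 2)
  not-diagnosable = diagnosability-bound
    (goodNeighbourFaulty openNbhd openNbhd⊆closedNbhd openNbhd-suffixInvariant)
    (goodNeighbourFaulty closedNbhd (λ _ e → e) closedNbhd-suffixInvariant)
    openNbhd≢closedNbhd
    (indistinguishable openNbhd-agrees-near-fault-free)
    size-openNbhd size-closedNbhd

n+2∸g≡k+2 : (k g : ℕ) → k + g + 2 ∸ g ≡ k + 2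
n+2∸g≡k+2 k g = trans (cong (_∸ g) (swap-summands k g)) (m+n∸n≡m (k + 2) g)
  where
  swap-summands : ∀ k g → k + g + 2 ≡ k + 2 + g
  swap-summands = solve-∀

-- The construction also works for g = 0.
theorem4 : (n g : ℕ) → 2 ≤ n → 1 ≤ g → g ≤ n ∸ 1 →
    (t : ℕ) → GoodNeighbourDiagnosable n g t →
    t ≤ 2 ^ g * (n + 2 ∸ g) ∸ 1
theorem4 (suc n′) g _ _ g≤n′ t diagnosable with n′ ∸ g | m∸n+n≡m g≤n′
... | k′ | refl = begin
  t                                   ≤⟨ <⇒≤pred (SubcubeNeighbourhood.not-diagnosable k′ g diagnosable) ⟩
  pred (2 ^ g * (suc k′ + 2))         ≡⟨ cong (λ m → pred (2 ^ g * m)) (sym (n+2∸g≡k+2 (suc k′) g)) ⟩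
  2 ^ g * (suc (k′ + g) + 2 ∸ g) ∸ 1  ∎
  where open ≤-Reasoning
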